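{- Let $G$ be a connected signed graph with frustration index $\varphi(G)$, edge connectivity $\kappa_e(G)$, and Gremban expansion $\mathcal{G}$. Define the symmetric edge connectivity $\kappa_e^{\mathrm{sym}}(\mathcal{G})=\min\{|\mathcal{C}|: \mathcal{C}\subseteq E(\mathcal{G}) \text{ is a Gremban-symmetric cut-set}\}$. Then $\kappa_e^{\mathrm{sym}}(\mathcal{G})=2\min\{\kappa_e(G),\varphi(G)\}$.
   Context: A signed graph $G=(V,E,\sigma)$ has finite node set, undirected edges without loops or multi-edges, and signs $\sigma:E\to\{\pm1\}$. Its Gremban expansion $\mathcal{G}$ is the unsigned graph on nodes $v^+,v^-$ ($v\in V$) with edges $(u^\chi,v^{\chi\sigma(u,v)})$ for $(u,v)\in E$, $\chi\in\{\pm\}$. The Gremban involution $\eta(v^\chi)=v^{ -\chi}$ acts on edges by $\eta((a,b))=(\eta(a),\eta(b))$; an edge set $\mathcal{C}$ is Gremban-symmetric if $\eta(\mathcal{C})=\mathcal{C}$. For a (signed or unsigned) graph and a bipartition of its node set into two nonempty sets $S,T$, the cut-set is $C(S,T)=\{(u,v)\in E: u\in S, v\in T\}$; a cut-set of $\mathcal{G}$ is any such $C(S,T)$ in $\mathcal{G}$. The edge connectivity $\kappa_e$ is the minimum size of a cut-set over all such bipartitions. For a switching function $\theta:V\to\{\pm1\}$ the frustration set is $F(\theta)=\{uv\in E:\theta(u)\theta(v)\sigma(uv)=-1\}$, and the frustration index is $\varphi(G)=\min_\theta|F(\theta)|$. -}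

module Defs where

open import Data.Bool using (Bool; true; false; _∧_; _∨_; not; if_then_else_)
open import Data.Nat using (ℕ; zero; suc; _≤_; _<ᵇ_)
open import Data.Fin using (Fin; toℕ)
open import Data.List using (List; []; _∷_; allFin; cartesianProduct)
open import Data.Product using (_×_; _,_; ∃)
open import Relation.Binary.PropositionalEquality using (_≡_)

data Sgn : Set where
  pos neg : Sgn

_·_ : Sgn → Sgn → Sgn
pos · s = s
neg · pos = neg
neg · neg = pos

_==ˢ_ : Sgn → Sgn → Bool
pos ==ˢ pos = true
neg ==ˢ neg = true
_   ==ˢ _   = false

count : {A : Set} → (A → Bool) → List A → ℕ
count p [] = 0
count p (x ∷ xs) = if p x then suc (count p xs) else count p xs

-- A signed graph on node set Fin n: symmetric loopless adjacency,
-- and a sign on each (unordered) pair, symmetric (only meaningful on edges).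
record SignedGraph (n : ℕ) : Set where
  field
    adj       : Fin n → Fin n → Bool
    sgn       : Fin n → Fin n → Sgn
    adj-sym   : ∀ u v → adj u v ≡ adj v u
    adj-irrefl : ∀ u → adj u u ≡ false
    sgn-sym   : ∀ u v → sgn u v ≡ sgn v u

module _ {n : ℕ} (G : SignedGraph n) where
  open SignedGraph G

  data Reach : Fin n → Fin n → Set where
    here : ∀ {u} → Reach u u
    step : ∀ {u v w} → adj u v ≡ true → Reach v w → Reach u w

  Connected : Set
  Connected = ∀ u v → Reach u v

  nodes : List (Fin n)
  nodes = allFin n

  -- a bipartition (S, T) of V given by S : V → Bool (T = complement), both nonempty
  Proper : (Fin n → Bool) → Set
  Proper S = ∃ (λ a → S a ≡ true) × ∃ (λ b → S b ≡ false)

  cutSize : (Fin n → Bool) → ℕ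
  cutSize S = count (λ { (u , v) → adj u v ∧ S u ∧ not (S v) })
                    (cartesianProduct nodes nodes)

  IsEdgeConnectivity : ℕ → Set
  IsEdgeConnectivity k =
    (∃ λ S → Proper S × cutSize S ≡ k) × (∀ S → Proper S → k ≤ cutSize S)

  frustration : (Fin n → Sgn) → ℕ
  frustration θ = count (λ { (u , v) → (toℕ u <ᵇ toℕ v) ∧ adj u v
                                       ∧ ((θ u · (θ v · sgn u v)) ==ˢ neg) })
                        (cartesianProduct nodes nodes)

  IsFrustrationIndex : ℕ → Set
  IsFrustrationIndex p =
    (∃ λ θ → frustration θ ≡ p) × (∀ θ → p ≤ frustration θ)

  -- Gremban expansion: nodes v^χ encoded as (χ , v)
  GNode : Set
  GNode = Sgn × Fin n

  gnodes : List GNode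
  gnodes = cartesianProduct (pos ∷ neg ∷ []) nodes

  gadj : GNode → GNode → Bool
  gadj (χ , u) (χ' , v) = adj u v ∧ (χ' ==ˢ (χ · sgn u v))

  η : GNode → GNode
  η (χ , v) = (neg · χ , v)

  GProper : (GNode → Bool) → Set
  GProper S = ∃ (λ a → S a ≡ true) × ∃ (λ b → S b ≡ false)

  inCut : (GNode → Bool) → GNode → GNode → Bool
  inCut S a b = (S a ∧ not (S b)) ∨ (S b ∧ not (S a))

  -- the cut-set C(S,T) of 𝒢 is Gremban-symmetric: η(C) = C, i.e.
  -- an edge {a,b} lies in C iff {η a, η b} lies in C
  GSymmetric : (GNode → Bool) → Set
  GSymmetric S = ∀ a b → gadj a b ≡ true → inCut S a b ≡ inCut S (η a) (η b)

  gcutSize : (GNode → Bool) → ℕ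
  gcutSize S = count (λ { (a , b) → gadj a b ∧ S a ∧ not (S b) })
                     (cartesianProduct gnodes gnodes)

  IsSymEdgeConnectivity : ℕ → Set
  IsSymEdgeConnectivity k =
    (∃ λ S → GProper S × GSymmetric S × gcutSize S ≡ k)
    × (∀ S → GProper S → GSymmetric S → k ≤ gcutSize S)

-- Call a node v mixed for a node set S of the Gremban expansion if exactly one of v⁺, v⁻
-- lies in S. Symmetry of the cut C(S) forces adjacent nodes to be equally mixed, so on a
-- connected graph either no node is mixed or every node is. In the first case S is the lift
-- {v^χ : v ∈ T} of a node set T of G, and C(S) consists of the two lifts of each edge of
-- C(T); in the second case S = {v^θ(v)} for a switching θ, and C(S) consists of the two lifts
-- of each edge of F(θ). Conversely, both kinds of lift are symmetric cuts.
module Submission where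

open import Data.Bool using (Bool; true; false; _∧_; _∨_; not; if_then_else_; _xor_)
open import Data.Bool.Properties using (xor-comm; xor-annihilates-not)
open import Data.Fin using (Fin; toℕ)
open import Data.Fin.Properties using (toℕ-injective)
open import Data.List using (List; []; _∷_; _++_; map; tabulate; allFin; cartesianProduct)
open import Data.List.Properties using (map-++; map-∘)
open import Data.Nat using (ℕ; zero; suc; _+_; _*_; _⊓_; _≤_; _<ᵇ_)
open import Data.Nat.ListAction using (sum)
open import Data.Nat.ListAction.Properties using (sum-++)
open import Data.Nat.Properties
  using ( +-identityʳ; +-0-commutativeMonoid; +-*-semiring; <ᵇ-reflects-<; <-asym; ≮⇒≥; ≤-antisym
        ; ≤-total; ≤-trans; ≤-reflexive; *-monoʳ-≤; m⊓n≤m; m⊓n≤n; m≤n⇒m⊓n≡m; m≥n⇒m⊓n≡n)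
open import Data.Product using (_×_; _,_; ∃; proj₁)
open import Data.Sum using (_⊎_; inj₁; inj₂)
open import Function using (_∘_; id)
open import Relation.Binary.PropositionalEquality
open import Relation.Nullary using (ofʸ; ofⁿ; contradiction)
open import Algebra.Properties.CommutativeMonoid.Sum +-0-commutativeMonoid
  using (sum-syntax; ∑-distrib-+; ∑-comm; sum-cong-≗)
open import Algebra.Properties.Semiring.Sum +-*-semiring using (*-distribˡ-sum)

open import Defs

open ≡-Reasoning

𝟙 : Bool → ℕ
𝟙 b = if b then 1 else 0

module _ {A : Set} where

  count≡sum-map : (p : A → Bool) (xs : List A) → count p xs ≡ sum (map (𝟙 ∘ p) xs)
  count≡sum-map p [] = refl
  count≡sum-map p (x ∷ xs) with p x
  ... | true  = cong suc (count≡sum-map p xs)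
  ... | false = count≡sum-map p xs

  count-cong : {p q : A → Bool} → p ≗ q → (xs : List A) → count p xs ≡ count q xs
  count-cong p≗q [] = refl
  count-cong p≗q (x ∷ xs) =
    cong₂ (λ b m → if b then suc m else m) (p≗q x) (count-cong p≗q xs)

  sum-map-tabulate : ∀ {n} (g : A → ℕ) (f : Fin n → A) →
    sum (map g (tabulate f)) ≡ ∑[ i < n ] g (f i)
  sum-map-tabulate {zero}  g f = refl
  sum-map-tabulate {suc n} g f = cong (g (f Fin.zero) +_) (sum-map-tabulate g (f ∘ Fin.suc))

sum-map-cartesianProduct : {A B : Set} (f : A × B → ℕ) (xs : List A) (ys : List B) →
  sum (map f (cartesianProduct xs ys)) ≡ sum (map (λ x → sum (map (λ y → f (x , y)) ys)) xs)
sum-map-cartesianProduct f [] ys = refl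
sum-map-cartesianProduct f (x ∷ xs) ys = begin
  sum (map f (map (x ,_) ys ++ cartesianProduct xs ys))
    ≡⟨ cong sum (map-++ f (map (x ,_) ys) _) ⟩
  sum (map f (map (x ,_) ys) ++ map f (cartesianProduct xs ys))
    ≡⟨ sum-++ (map f (map (x ,_) ys)) _ ⟩
  sum (map f (map (x ,_) ys)) + sum (map f (cartesianProduct xs ys))
    ≡⟨ cong₂ _+_ (cong sum (sym (map-∘ ys))) (sum-map-cartesianProduct f xs ys) ⟩
  sum (map (λ y → f (x , y)) ys) + sum (map (λ x → sum (map (λ y → f (x , y)) ys)) xs) ∎

count-allFin² : ∀ {n} (p : Fin n × Fin n → Bool) →
  count p (cartesianProduct (allFin n) (allFin n)) ≡ ∑[ u < n ] ∑[ v < n ] 𝟙 (p (u , v))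
count-allFin² {n} p = begin
  count p (cartesianProduct (allFin n) (allFin n))
    ≡⟨ count≡sum-map p (cartesianProduct (allFin n) (allFin n)) ⟩
  sum (map (𝟙 ∘ p) (cartesianProduct (allFin n) (allFin n)))
    ≡⟨ sum-map-cartesianProduct (𝟙 ∘ p) (allFin n) (allFin n) ⟩
  sum (map (λ u → sum (map (λ v → 𝟙 (p (u , v))) (allFin n))) (allFin n))
    ≡⟨ sum-map-tabulate (λ u → sum (map (λ v → 𝟙 (p (u , v))) (allFin n))) id ⟩
  ∑[ u < n ] sum (map (λ v → 𝟙 (p (u , v))) (allFin n))
    ≡⟨ sum-cong-≗ (λ u → sum-map-tabulate (λ v → 𝟙 (p (u , v))) id) ⟩
  ∑[ u < n ] ∑[ v < n ] 𝟙 (p (u , v)) ∎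

module _ {n : ℕ} (R : Fin n → Fin n → Bool)
         (R-sym : ∀ u v → R u v ≡ R v u) (R-irrefl : ∀ u → R u u ≡ false) where

  private
    R< : Fin n → Fin n → ℕ
    R< u v = 𝟙 ((toℕ u <ᵇ toℕ v) ∧ R u v)

    𝟙-split-by-order : ∀ u v → 𝟙 (R u v) ≡ 𝟙 ((toℕ u <ᵇ toℕ v) ∧ R u v) + 𝟙 ((toℕ v <ᵇ toℕ u) ∧ R v u)
    𝟙-split-by-order u v
      with toℕ u <ᵇ toℕ v | <ᵇ-reflects-< (toℕ u) (toℕ v)
         | toℕ v <ᵇ toℕ u | <ᵇ-reflects-< (toℕ v) (toℕ u)
    ... | true  | ofʸ u<v | true  | ofʸ v<u = contradiction v<u (<-asym u<v)
    ... | true  | _       | false | _       = sym (+-identityʳ _)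
    ... | false | _       | true  | _       = cong 𝟙 (R-sym u v)
    ... | false | ofⁿ u≮v | false | ofⁿ v≮u = cong 𝟙 (trans (cong (R u) (sym u≡v)) (R-irrefl u))
      where
      u≡v : u ≡ v
      u≡v = toℕ-injective (≤-antisym (≮⇒≥ v≮u) (≮⇒≥ u≮v))

  ∑∑-symmetric : ∑[ u < n ] ∑[ v < n ] 𝟙 (R u v)
               ≡ 2 * ∑[ u < n ] ∑[ v < n ] 𝟙 ((toℕ u <ᵇ toℕ v) ∧ R u v)
  ∑∑-symmetric = begin
    ∑[ u < n ] ∑[ v < n ] 𝟙 (R u v)
      ≡⟨ sum-cong-≗ (λ u → sum-cong-≗ (𝟙-split-by-order u)) ⟩
    ∑[ u < n ] ∑[ v < n ] (R< u v + R< v u)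
      ≡⟨ sum-cong-≗ (λ u → ∑-distrib-+ (R< u) (λ v → R< v u)) ⟩
    ∑[ u < n ] (∑[ v < n ] R< u v + ∑[ v < n ] R< v u)
      ≡⟨ ∑-distrib-+ (λ u → ∑[ v < n ] R< u v) (λ u → ∑[ v < n ] R< v u) ⟩
    X + ∑[ u < n ] ∑[ v < n ] R< v u
      ≡⟨ cong (X +_) (∑-comm (λ u v → R< v u)) ⟩
    X + X
      ≡⟨ cong (X +_) (sym (+-identityʳ X)) ⟩
    2 * X ∎
    where
    X : ℕ
    X = ∑[ u < n ] ∑[ v < n ] R< u v

xor-swap : ∀ a b c d → a xor b ≡ c xor d → a xor c ≡ b xor d
xor-swap true  true  true  true  _ = refl
xor-swap true  true  false false _ = refl
xor-swap true  false true  false _ = refl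
xor-swap true  false false true  _ = refl
xor-swap false true  true  false _ = refl
xor-swap false true  false true  _ = refl
xor-swap false false true  true  _ = refl
xor-swap false false false false _ = refl
xor-swap true  true  true  false ()
xor-swap true  true  false true  ()
xor-swap true  false true  true  ()
xor-swap true  false false false ()
xor-swap false true  true  true  ()
xor-swap false true  false false ()
xor-swap false false true  false ()
xor-swap false false false true  ()

xor-false⇒≡ : ∀ x y → x xor y ≡ false → y ≡ x
xor-false⇒≡ true  true  _ = refl
xor-false⇒≡ false false _ = refl

cut-indicator≡xor : ∀ x y → (x ∧ not y) ∨ (y ∧ not x) ≡ x xor y
cut-indicator≡xor true  true  = refl
cut-indicator≡xor true  false = refl
cut-indicator≡xor false true  = refl
cut-indicator≡xor false false = refl

==ˢ-refl : ∀ s → (s ==ˢ s) ≡ true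
==ˢ-refl pos = refl
==ˢ-refl neg = refl

neg·s==ˢs : ∀ s → ((neg · s) ==ˢ s) ≡ false
neg·s==ˢs pos = refl
neg·s==ˢs neg = refl

neg·χ==ˢs : ∀ χ s → ((neg · χ) ==ˢ s) ≡ not (χ ==ˢ s)
neg·χ==ˢs pos pos = refl
neg·χ==ˢs pos neg = refl
neg·χ==ˢs neg pos = refl
neg·χ==ˢs neg neg = refl

·-swap : ∀ a b c → a · (b · c) ≡ b · (a · c)
·-swap pos b   c   = refl
·-swap neg pos c   = refl
·-swap neg neg pos = refl
·-swap neg neg neg = refl

signOf : Bool → Sgn
signOf x = if x then pos else neg

pos==ˢsignOf : ∀ x → x ≡ (pos ==ˢ signOf x)
pos==ˢsignOf true  = refl
pos==ˢsignOf false = refl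

xor-true⇒neg==ˢsignOf : ∀ x y → x xor y ≡ true → y ≡ (neg ==ˢ signOf x)
xor-true⇒neg==ˢsignOf true  false _ = refl
xor-true⇒neg==ˢsignOf false true  _ = refl

-- For an edge uv of sign s with θ u = a and θ v = b: if uv is frustrated, both lifts of uv
-- are cut by {w^θ(w)}, but only one of them runs from that set to its complement in the
-- direction u → v; otherwise neither is cut.
switching-lifts : ∀ c a b s →
  𝟙 (c ∧ (pos ==ˢ a) ∧ not (s ==ˢ b)) + 𝟙 (c ∧ (neg ==ˢ a) ∧ not ((neg · s) ==ˢ b))
  ≡ 𝟙 (c ∧ ((a · (b · s)) ==ˢ neg))
switching-lifts false a   b   s   = refl
switching-lifts true  pos pos pos = refl
switching-lifts true  pos pos neg = refl
switching-lifts true  pos neg pos = refl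
switching-lifts true  pos neg neg = refl
switching-lifts true  neg pos pos = refl
switching-lifts true  neg pos neg = refl
switching-lifts true  neg neg pos = refl
switching-lifts true  neg neg neg = refl

module _ {n : ℕ} (G : SignedGraph n) where
  open SignedGraph G

  liftSet : (Fin n → Bool) → GNode G → Bool
  liftSet T (χ , v) = T v

  liftSwitching : (Fin n → Sgn) → GNode G → Bool
  liftSwitching θ (χ , v) = χ ==ˢ θ v

  frustrated : (Fin n → Sgn) → Fin n → Fin n → Bool
  frustrated θ u v = adj u v ∧ ((θ u · (θ v · sgn u v)) ==ˢ neg)

  liftedCut : (GNode G → Bool) → Fin n → Fin n → ℕ
  liftedCut S u v = 𝟙 (adj u v ∧ S (pos , u) ∧ not (S (sgn u v , v)))
                  + 𝟙 (adj u v ∧ S (neg , u) ∧ not (S (neg · sgn u v , v)))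

  cutSize≡∑∑ : ∀ T → cutSize G T ≡ ∑[ u < n ] ∑[ v < n ] 𝟙 (adj u v ∧ T u ∧ not (T v))
  cutSize≡∑∑ T = count-allFin² {n} _

  frustration≡∑∑ : ∀ θ →
    frustration G θ ≡ ∑[ u < n ] ∑[ v < n ] 𝟙 ((toℕ u <ᵇ toℕ v) ∧ frustrated θ u v)
  frustration≡∑∑ θ = count-allFin² {n} _

  sum-map-gnodes : (g : GNode G → ℕ) →
    sum (map g (gnodes G)) ≡ ∑[ v < n ] (g (pos , v) + g (neg , v))
  sum-map-gnodes g = begin
    sum (map g (gnodes G))
      ≡⟨ sum-map-cartesianProduct g (pos ∷ neg ∷ []) (nodes G) ⟩
    g⁺ + (g⁻ + 0)
      ≡⟨ cong (g⁺ +_) (+-identityʳ g⁻) ⟩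
    g⁺ + g⁻
      ≡⟨ cong₂ _+_ (sum-map-tabulate (λ v → g (pos , v)) id)
                   (sum-map-tabulate (λ v → g (neg , v)) id) ⟩
    ∑[ v < n ] g (pos , v) + ∑[ v < n ] g (neg , v)
      ≡⟨ sym (∑-distrib-+ (λ v → g (pos , v)) (λ v → g (neg , v))) ⟩
    ∑[ v < n ] (g (pos , v) + g (neg , v)) ∎
    where
    g⁺ g⁻ : ℕ
    g⁺ = sum (map (λ v → g (pos , v)) (nodes G))
    g⁻ = sum (map (λ v → g (neg , v)) (nodes G))

  gcutSize≡∑∑liftedCut : ∀ S → gcutSize G S ≡ ∑[ u < n ] ∑[ v < n ] liftedCut S u v
  gcutSize≡∑∑liftedCut S = begin
    gcutSize G S
      ≡⟨ count≡sum-map _ (cartesianProduct (gnodes G) (gnodes G)) ⟩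
    sum (map (λ { (a , b) → cut a b }) (cartesianProduct (gnodes G) (gnodes G)))
      ≡⟨ sum-map-cartesianProduct _ (gnodes G) (gnodes G) ⟩
    sum (map (λ a → sum (map (cut a) (gnodes G))) (gnodes G))
      ≡⟨ sum-map-gnodes (λ a → sum (map (cut a) (gnodes G))) ⟩
    ∑[ u < n ] (sum (map (cut (pos , u)) (gnodes G)) + sum (map (cut (neg , u)) (gnodes G)))
      ≡⟨ sum-cong-≗ (λ u → cong₂ _+_ (sum-map-gnodes (cut (pos , u)))
                                       (sum-map-gnodes (cut (neg , u)))) ⟩
    ∑[ u < n ] (∑[ v < n ] cuts pos u v + ∑[ v < n ] cuts neg u v)
      ≡⟨ sum-cong-≗ (λ u → sym (∑-distrib-+ (cuts pos u) (cuts neg u))) ⟩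
    ∑[ u < n ] ∑[ v < n ] (cuts pos u v + cuts neg u v)
      ≡⟨ sum-cong-≗ (λ u → sum-cong-≗ (only-lifted-edges u)) ⟩
    ∑[ u < n ] ∑[ v < n ] liftedCut S u v ∎
    where
    cut : GNode G → GNode G → ℕ
    cut a b = 𝟙 (gadj G a b ∧ S a ∧ not (S b))

    cuts : Sgn → Fin n → Fin n → ℕ
    cuts χ u v = cut (χ , u) (pos , v) + cut (χ , u) (neg , v)

    only-lifted-edges : ∀ u v → cuts pos u v + cuts neg u v ≡ liftedCut S u v
    only-lifted-edges u v with adj u v | sgn u v
    ... | false | _   = refl
    ... | true  | pos = cong (_+ 𝟙 (S (neg , u) ∧ not (S (neg , v))))
                             (+-identityʳ (𝟙 (S (pos , u) ∧ not (S (pos , v)))))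
    ... | true  | neg = cong (𝟙 (S (pos , u) ∧ not (S (neg , v))) +_)
                             (+-identityʳ (𝟙 (S (neg , u) ∧ not (S (pos , v)))))

  gcutSize-cong : ∀ {S S′} → S ≗ S′ → gcutSize G S ≡ gcutSize G S′
  gcutSize-cong S≗S′ =
    count-cong (λ { (a , b) → cong₂ (λ x y → gadj G a b ∧ x ∧ not y) (S≗S′ a) (S≗S′ b) })
      (cartesianProduct (gnodes G) (gnodes G))

  gcutSize-liftSet : ∀ T → gcutSize G (liftSet T) ≡ 2 * cutSize G T
  gcutSize-liftSet T = begin
    gcutSize G (liftSet T)
      ≡⟨ gcutSize≡∑∑liftedCut (liftSet T) ⟩
    ∑[ u < n ] ∑[ v < n ] (e u v + e u v)
      ≡⟨ sum-cong-≗ (λ u → sum-cong-≗ (λ v → cong (e u v +_) (sym (+-identityʳ (e u v))))) ⟩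
    ∑[ u < n ] ∑[ v < n ] (2 * e u v)
      ≡⟨ sum-cong-≗ (λ u → sym (*-distribˡ-sum {n} 2 (e u))) ⟩
    ∑[ u < n ] (2 * ∑[ v < n ] e u v)
      ≡⟨ sym (*-distribˡ-sum {n} 2 (λ u → ∑[ v < n ] e u v)) ⟩
    2 * ∑[ u < n ] ∑[ v < n ] e u v
      ≡⟨ cong (2 *_) (sym (cutSize≡∑∑ T)) ⟩
    2 * cutSize G T ∎
    where
    e : Fin n → Fin n → ℕ
    e u v = 𝟙 (adj u v ∧ T u ∧ not (T v))

  frustrated-sym : ∀ θ u v → frustrated θ u v ≡ frustrated θ v u
  frustrated-sym θ u v
    rewrite adj-sym u v | sgn-sym u v | ·-swap (θ u) (θ v) (sgn v u) = refl

  frustrated-irrefl : ∀ θ u → frustrated θ u u ≡ false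
  frustrated-irrefl θ u rewrite adj-irrefl u = refl

  gcutSize-liftSwitching : ∀ θ → gcutSize G (liftSwitching θ) ≡ 2 * frustration G θ
  gcutSize-liftSwitching θ = begin
    gcutSize G (liftSwitching θ)
      ≡⟨ gcutSize≡∑∑liftedCut (liftSwitching θ) ⟩
    ∑[ u < n ] ∑[ v < n ] liftedCut (liftSwitching θ) u v
      ≡⟨ sum-cong-≗ (λ u → sum-cong-≗ (λ v →
           switching-lifts (adj u v) (θ u) (θ v) (sgn u v))) ⟩
    ∑[ u < n ] ∑[ v < n ] 𝟙 (frustrated θ u v)
      ≡⟨ ∑∑-symmetric (frustrated θ) (frustrated-sym θ) (frustrated-irrefl θ) ⟩
    2 * ∑[ u < n ] ∑[ v < n ] 𝟙 ((toℕ u <ᵇ toℕ v) ∧ frustrated θ u v)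
      ≡⟨ cong (2 *_) (sym (frustration≡∑∑ θ)) ⟩
    2 * frustration G θ ∎

  liftSet-proper : ∀ {T} → Proper G T → GProper G (liftSet T)
  liftSet-proper ((a , Ta) , (b , Tb)) = ((pos , a) , Ta) , ((pos , b) , Tb)

  liftSwitching-proper : ∀ θ → Fin n → GProper G (liftSwitching θ)
  liftSwitching-proper θ v = ((θ v , v) , ==ˢ-refl (θ v)) , ((neg · θ v , v) , neg·s==ˢs (θ v))

  proper-of-≗liftSet : ∀ {S T} → S ≗ liftSet T → GProper G S → Proper G T
  proper-of-≗liftSet S≗T (((_ , a) , Sa) , ((_ , b) , Sb)) =
    (a , trans (sym (S≗T _)) Sa) , (b , trans (sym (S≗T _)) Sb)

  inCut≡xor : ∀ S a b → inCut G S a b ≡ S a xor S b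
  inCut≡xor S a b = cut-indicator≡xor (S a) (S b)

  liftSet-symmetric : ∀ T → GSymmetric G (liftSet T)
  liftSet-symmetric T a b _ = refl

  liftSwitching-symmetric : ∀ θ → GSymmetric G (liftSwitching θ)
  liftSwitching-symmetric θ a@(χ , u) b@(χ′ , v) _ = begin
    inCut G S a b                 ≡⟨ inCut≡xor S a b ⟩
    S a xor S b                   ≡⟨ xor-annihilates-not (S a) (S b) ⟨
    not (S a) xor not (S b)       ≡⟨ cong₂ _xor_ (neg·χ==ˢs χ (θ u)) (neg·χ==ˢs χ′ (θ v)) ⟨
    S (η G a) xor S (η G b)       ≡⟨ inCut≡xor S (η G a) (η G b) ⟨
    inCut G S (η G a) (η G b)     ∎
    where
    S : GNode G → Bool
    S = liftSwitching θ

  mixed : (GNode G → Bool) → Fin n → Bool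
  mixed S v = S (pos , v) xor S (neg , v)

  mixed-η : ∀ S χ v → S (χ , v) xor S (neg · χ , v) ≡ mixed S v
  mixed-η S pos v = refl
  mixed-η S neg v = xor-comm (S (neg , v)) (S (pos , v))

  mixed-edge : ∀ {S} → GSymmetric G S → ∀ {u v} → adj u v ≡ true → mixed S u ≡ mixed S v
  mixed-edge {S} S-sym {u} {v} uv = begin
    S (pos , u) xor S (neg , u)
      ≡⟨ xor-swap (S (pos , u)) (S (σ , v)) (S (neg , u)) (S (neg · σ , v)) lifts-cut-together ⟩
    S (σ , v) xor S (neg · σ , v)
      ≡⟨ mixed-η S σ v ⟩
    mixed S v ∎
    where
    σ : Sgn
    σ = sgn u v

    lifts-cut-together : S (pos , u) xor S (σ , v) ≡ S (neg , u) xor S (neg · σ , v)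
    lifts-cut-together = begin
      S (pos , u) xor S (σ , v)         ≡⟨ inCut≡xor S _ _ ⟨
      inCut G S (pos , u) (σ , v)       ≡⟨ S-sym (pos , u) (σ , v) (cong₂ _∧_ uv (==ˢ-refl σ)) ⟩
      inCut G S (neg , u) (neg · σ , v) ≡⟨ inCut≡xor S _ _ ⟩
      S (neg , u) xor S (neg · σ , v)   ∎

  mixed-reach : ∀ {S} → GSymmetric G S → ∀ {u v} → Reach G u v → mixed S u ≡ mixed S v
  mixed-reach     S-sym here         = refl
  mixed-reach {S} S-sym (step uv vw) = trans (mixed-edge {S} S-sym uv) (mixed-reach {S} S-sym vw)

  symmetric-lift : Connected G → ∀ {S} → GSymmetric G S → Fin n →
    (S ≗ liftSet (λ v → S (pos , v))) ⊎ (S ≗ liftSwitching (λ v → signOf (S (pos , v))))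
  symmetric-lift conn {S} S-sym v₀ with mixed S v₀ in mixed-v₀
  ... | false = inj₁ λ where
        (pos , v) → refl
        (neg , v) → xor-false⇒≡ (S (pos , v)) (S (neg , v))
                      (trans (mixed-reach {S} S-sym (conn v v₀)) mixed-v₀)
  ... | true  = inj₂ λ where
        (pos , v) → pos==ˢsignOf (S (pos , v))
        (neg , v) → xor-true⇒neg==ˢsignOf (S (pos , v)) (S (neg , v))
                      (trans (mixed-reach {S} S-sym (conn v v₀)) mixed-v₀)

  symmetric-cut-size : Connected G → ∀ {S} → GProper G S → GSymmetric G S →
    (∃ λ T → Proper G T × gcutSize G S ≡ 2 * cutSize G T)
    ⊎ (∃ λ θ → gcutSize G S ≡ 2 * frustration G θ)
  symmetric-cut-size conn {S} S-proper@(((_ , v₀) , _) , _) S-sym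
    with symmetric-lift conn {S} S-sym v₀
  ... | inj₁ S≗T = inj₁ (T , proper-of-≗liftSet S≗T S-proper ,
                         trans (gcutSize-cong S≗T) (gcutSize-liftSet T))
    where
    T : Fin n → Bool
    T v = S (pos , v)
  ... | inj₂ S≗θ = inj₂ (θ , trans (gcutSize-cong S≗θ) (gcutSize-liftSwitching θ))
    where
    θ : Fin n → Sgn
    θ v = signOf (S (pos , v))

proposition9 : ∀ {n} (G : SignedGraph n) → Connected G →
    ∀ k p → IsEdgeConnectivity G k → IsFrustrationIndex G p →
    IsSymEdgeConnectivity G (2 * (k ⊓ p))
proposition9 G conn k p ((T , T-proper , cutT≡k) , κ-min) ((θ , Fθ≡p) , φ-min) =
  attained , bounded
  where
  attained : ∃ λ S → GProper G S × GSymmetric G S × gcutSize G S ≡ 2 * (k ⊓ p)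
  attained with ≤-total k p
  ... | inj₁ k≤p = liftSet G T , liftSet-proper G T-proper , liftSet-symmetric G T ,
        trans (gcutSize-liftSet G T) (cong (2 *_) (trans cutT≡k (sym (m≤n⇒m⊓n≡m k≤p))))
  ... | inj₂ p≤k = liftSwitching G θ , liftSwitching-proper G θ (proj₁ (proj₁ T-proper)) ,
        liftSwitching-symmetric G θ ,
        trans (gcutSize-liftSwitching G θ) (cong (2 *_) (trans Fθ≡p (sym (m≥n⇒m⊓n≡n p≤k))))

  bounded : ∀ S → GProper G S → GSymmetric G S → 2 * (k ⊓ p) ≤ gcutSize G S
  bounded S S-proper S-sym with symmetric-cut-size G conn S-proper S-sym
  ... | inj₁ (T′ , T′-proper , eq) =
        ≤-trans (*-monoʳ-≤ 2 (≤-trans (m⊓n≤m k p) (κ-min T′ T′-proper))) (≤-reflexive (sym eq))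
  ... | inj₂ (θ′ , eq) =
        ≤-trans (*-monoʳ-≤ 2 (≤-trans (m⊓n≤n k p) (φ-min θ′))) (≤-reflexive (sym eq))
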